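{- Let $a,b$ be coprime positive integers with $b>1$, and let $Q$ be a $0$-stable path in $\mathcal{P}$. (a) $Q$ is $(b-1)$-skeletal if and only if $Q$ is an $(a,b)$-Dyck path. (b) $Q$ is $0$-skeletal if and only if $\widehat{Q}$ is an inverted $(a,b)$-Dyck path. (c) The map sending an $(a,b)$-Dyck path $Q$ to the path $Q^*$ that starts at $(-e,0)$ and whose step sequence is the reverse of the step sequence of $Q$ is a bijection from $(a,b)$-Dyck paths to inverted $(a,b)$-Dyck paths. (d) The analogues of (a), (b) and (c) hold for labeled paths, where $\widehat{Q}$ carries the labels of $Q$ along with their north steps, and for (c) the labeled path $Q^*$ is obtained by reversing the sequence of steps of $Q$ (labels moving with their north steps) and then re-sorting the labels within each maximal run of north steps to increase from bottom to top.
   Context: Let $\mathcal{P}$ be the set of lattice paths from $(0,0)$ to $(a,b)$ with $b$ unit north steps and $a$ unit east steps. The level of a lattice point $(x,y)$ is $ay-bx$. A path is an $(a,b)$-Dyck path if all its north steps start at points of level $\ge0$. For $Q\in\mathcal{P}$ and a lattice point $v$ on $Q$, $Q_v$ is the path from the origin whose steps are those of $Q$ from $v$ to $(a,b)$ followed by those of $Q$ from $(0,0)$ to $v$. For $0\le k<b$, $Q$ is $k$-stable if its last $k+1$ north steps start at points of level $\ge0$; $Q$ is $k$-skeletal if $Q$ is $k$-stable and, for every lattice point $v$ on $Q$ of level $>0$, $Q_v$ is not $k$-stable. A labeled path is a path in $\mathcal{P}$ with labels $1,\dots,b$ assigned bijectively to its north steps, increasing bottom to top within each maximal run of consecutive north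 steps; it is $k$-stable/$k$-skeletal/Dyck if its underlying path is. Let $e=1+\lfloor a/b\rfloor$. Any $0$-stable $Q$ ends with at least $e$ east steps; $\widehat{Q}$ denotes the path from $(-e,0)$ to $(a-e,b)$ obtained from $Q$ by moving its last $e$ east steps to the beginning. Let $\Delta'$ be the closed triangle with vertices $(-e,0)$, $(a-e,0)$, $(a-e,b)$. An inverted $(a,b)$-Dyck path (labeled or not) is a lattice path from $(-e,0)$ to $(a-e,b)$ with unit north and east steps that stays within $\Delta'$. -}

module Defs where

open import Data.Nat as ℕ using (ℕ; zero; suc; _/_)
open import Data.Nat.Properties using (≤-decTotalOrder)
open import Data.Integer as ℤ using (ℤ; +_; -_; _-_)
open import Data.Product using (_×_; _,_; Σ; ∃; ∃-syntax)
open import Data.List using (List; []; _∷_; _++_; [_]; map; length; take; drop; reverse; upTo)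
open import Data.List.Relation.Unary.All using (All)
open import Data.List.Relation.Unary.Linked using (Linked)
open import Data.List.Relation.Binary.Permutation.Propositional using (_↭_)
open import Data.List.Sort.MergeSort ≤-decTotalOrder using (mergeSort)
open import Data.List.Sort.Base using (SortingAlgorithm)
open import Relation.Nullary using (¬_)
open import Relation.Binary.PropositionalEquality using (_≡_)
open import Data.Unit using (⊤)

-- Unlabeled paths: lists of unit steps (N = north, E = east),
-- starting at the origin unless said otherwise.

data Step : Set where
  N E : Step

#N : List Step → ℕ
#N []       = 0
#N (N ∷ s)  = suc (#N s)
#N (E ∷ s)  = #N s

#E : List Step → ℕ
#E []       = 0
#E (N ∷ s)  = #E s
#E (E ∷ s)  = suc (#E s)

InP : ℕ → ℕ → List Step → Set
InP a b Q = #E Q ≡ a × #N Q ≡ b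

endpoint : List Step → ℕ × ℕ
endpoint Q = (#E Q , #N Q)

level : ℕ → ℕ → ℕ × ℕ → ℤ
level a b (x , y) = + (a ℕ.* y) - + (b ℕ.* x)

northStartsFrom : ℕ × ℕ → List Step → List (ℕ × ℕ)
northStartsFrom p       []      = []
northStartsFrom (x , y) (N ∷ s) = (x , y) ∷ northStartsFrom (x , suc y) s
northStartsFrom (x , y) (E ∷ s) = northStartsFrom (suc x , y) s

northStarts : List Step → List (ℕ × ℕ)
northStarts = northStartsFrom (0 , 0)

NonNegLevel : ℕ → ℕ → ℕ × ℕ → Set
NonNegLevel a b p = + 0 ℤ.≤ level a b p

IsDyck : ℕ → ℕ → List Step → Set
IsDyck a b Q = InP a b Q × All (NonNegLevel a b) (northStarts Q)

-- k-stable: the last k+1 north steps start at level ≥ 0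
KStable : ℕ → ℕ → ℕ → List Step → Set
KStable a b k Q =
  All (NonNegLevel a b) (drop (length (northStarts Q) ℕ.∸ suc k) (northStarts Q))

-- Q_v for v the lattice point of Q reached after i steps
rotate : ℕ → List Step → List Step
rotate i Q = drop i Q ++ take i Q

-- k-skeletal: k-stable, and no Q_v (v on Q of positive level) is k-stable.
-- The lattice points of Q are exactly the endpoints of take i Q, 0 ≤ i ≤ length Q.
KSkeletal : ℕ → ℕ → ℕ → List Step → Set
KSkeletal a b k Q =
  KStable a b k Q ×
  ((i : ℕ) → i ℕ.≤ length Q → + 0 ℤ.< level a b (endpoint (take i Q)) →
     ¬ KStable a b k (rotate i Q))

-- e = 1 + ⌊a/b⌋  (b = 0 is never used; junk value 1)
eOf : ℕ → ℕ → ℕ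
eOf a zero    = 1
eOf a (suc b) = suc (a / suc b)

-- Q̂ : move the last e steps to the front
-- (as a step sequence; it is regarded as starting at (-e,0))
hat : ℕ → List Step → List Step
hat e Q = drop (length Q ℕ.∸ e) Q ++ take (length Q ℕ.∸ e) Q

pointsFrom : ℤ × ℤ → List Step → List (ℤ × ℤ)
pointsFrom p       []      = p ∷ []
pointsFrom (x , y) (N ∷ s) = (x , y) ∷ pointsFrom (x , y ℤ.+ + 1) s
pointsFrom (x , y) (E ∷ s) = (x , y) ∷ pointsFrom (x ℤ.+ + 1 , y) s

-- closed triangle Δ' with vertices (-e,0), (a-e,0), (a-e,b):
--   y ≥ 0,  x ≤ a - e,  a*y ≤ b*(x + e)
InΔ' : ℕ → ℕ → ℕ → ℤ × ℤ → Set
InΔ' a b e (x , y) =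
  (+ 0 ℤ.≤ y) × (x ℤ.≤ + a - + e) × (+ a ℤ.* y ℤ.≤ + b ℤ.* (x ℤ.+ + e))

-- inverted (a,b)-Dyck path: step sequence of a lattice path from (-e,0) to
-- (a-e,b) (i.e. a east and b north steps) all of whose lattice points lie in Δ'
-- (Δ' is convex, so this is the same as the whole path staying in Δ')
IsInvDyck : ℕ → ℕ → List Step → Set
IsInvDyck a b R = InP a b R × All (InΔ' a b (eOf a b)) (pointsFrom (- + eOf a b , + 0) R)

data LStep : Set where
  LN : ℕ → LStep
  LE : LStep

forget : List LStep → List Step
forget []         = []
forget (LN _ ∷ s) = N ∷ forget s
forget (LE ∷ s)   = E ∷ forget s

labels : List LStep → List ℕ
labels []         = []
labels (LN i ∷ s) = i ∷ labels s
labels (LE ∷ s)   = labels s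

data RunOrder : LStep → LStep → Set where
  nn : ∀ {i j} → i ℕ.< j → RunOrder (LN i) (LN j)
  ne : ∀ {i} → RunOrder (LN i) LE
  en : ∀ {j} → RunOrder LE (LN j)
  ee : RunOrder LE LE

ValidLabels : ℕ → List LStep → Set
ValidLabels b Q = labels Q ↭ map suc (upTo b) × Linked RunOrder Q

IsLabeledPath : ℕ → ℕ → List LStep → Set
IsLabeledPath a b Q = InP a b (forget Q) × ValidLabels b Q

IsLabeledDyck : ℕ → ℕ → List LStep → Set
IsLabeledDyck a b Q = IsDyck a b (forget Q) × ValidLabels b Q

IsLabeledInvDyck : ℕ → ℕ → List LStep → Set
IsLabeledInvDyck a b Q = IsInvDyck a b (forget Q) × ValidLabels b Q

lhat : ℕ → List LStep → List LStep
lhat e Q = drop (length Q ℕ.∸ e) Q ++ take (length Q ℕ.∸ e) Q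

sortℕ : List ℕ → List ℕ
sortℕ = SortingAlgorithm.sort mergeSort

-- re-sort the labels within each maximal run of north steps increasingly
-- (acc = labels of the current run read so far)
sortRunsAcc : List ℕ → List LStep → List LStep
sortRunsAcc acc []         = map LN (sortℕ acc)
sortRunsAcc acc (LN i ∷ s) = sortRunsAcc (acc ++ [ i ]) s
sortRunsAcc acc (LE ∷ s)   = map LN (sortℕ acc) ++ LE ∷ sortRunsAcc [] s

sortRuns : List LStep → List LStep
sortRuns = sortRunsAcc []

lstar : List LStep → List LStep
lstar Q = sortRuns (reverse Q)

{-# OPTIONS --safe #-}
module Submission where

-- Write height X for the level of the endpoint of a prefix X: it is additive, a path Q in 𝒫
-- has height 0, so a suffix S of Q = P ++ S has height S = - height P.
--
-- (a) There are b north steps, so (b-1)-stability is the Dyck condition, which says that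
-- every prefix has height ≥ 0. A rotation Q_v = S ++ P at a point of positive height
-- begins with S, of negative height, so it is never Dyck.
--
-- (b) If the last north step starts at height h ≥ 0 and is followed by k east steps, then
-- h + a = k b, so k b ≥ a and, b not dividing a, k ≥ e. More generally, for v reached by a
-- north step and then k east steps, Q_v is 0-stable iff k b ≥ a, i.e. iff k ≥ e; so
-- 0-skeletality says that every north step followed by e east steps ends at height ≤ e b.
-- Between two north steps separated by j < e east steps the height rises by a - j b > 0,
-- hence this bounds every height by e b, which is exactly the statement that Q̂, a rotation
-- of Q by e east steps, stays in Δ'.
--
-- (c), (d) A path from (-e,0) to (a-e,b) stays in Δ' iff all its prefixes have height ≤ 0,
-- and reversal turns prefixes of height ≥ 0 into prefixes of height ≤ 0, since prefixes of
-- reverse Q are reversed suffixes of Q. On labeled paths whose runs increase, Q* reverses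
-- the order of the runs and keeps each run, so it is an involution.

open import Defs
open import Algebra.Definitions using (Commutative)
open import Data.Integer as ℤ using (ℤ; +_; -_; _-_; +≤+)
import Data.Integer.Properties as ℤₚ
open import Data.Integer.Tactic.RingSolver using (solve-∀)
open import Data.List using (List; []; _∷_; _++_; [_]; _∷ʳ_; length; take; drop; reverse; replicate; map; upTo)
import Data.List.Properties as Listₚ
open import Data.List.Relation.Binary.Permutation.Propositional using (_↭_; ↭-trans; ↭⇒↭ₛ)
import Data.List.Relation.Binary.Permutation.Propositional.Properties as ↭ₚ
open import Data.List.Relation.Binary.Pointwise using (Pointwise-≡⇒≡)
open import Data.List.Relation.Unary.All using (All; []; _∷_)
import Data.List.Relation.Unary.All.Properties as Allₚ
open import Data.List.Relation.Unary.Linked as Linked using (Linked; []; [-]; _∷_)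
import Data.List.Relation.Unary.Linked.Properties as Linkedₚ
open import Data.List.Relation.Unary.Sorted.TotalOrder.Properties using (↗↭↗⇒≋)
open import Data.List.Sort.Base using (SortingAlgorithm)
open import Data.Nat as ℕ using (ℕ; zero; suc; z≤n; s≤s)
open import Data.Nat.Coprimality using (Coprime)
open import Data.Nat.Divisibility using (divides; ∣-refl)
open import Data.Nat.DivMod using (_/_; _%_; m≡m%n+[m/n]*n; m%n<n; m/n*n≤m)
import Data.Nat.Properties as ℕₚ
open import Data.List.Sort.MergeSort ℕₚ.≤-decTotalOrder using (mergeSort)
open import Data.Product using (_×_; _,_; ∃-syntax; proj₁; proj₂)
open import Data.Sum using (_⊎_; inj₁; inj₂)
open import Function using (id; _∘_)
open import Function.Bundles using (_⇔_; mk⇔; Equivalence)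
open import Function.Properties.Equivalence using (⇔-setoid)
open import Level using (0ℓ)
open import Relation.Binary.PropositionalEquality hiding ([_])
import Relation.Binary.Reasoning.Setoid as SetoidReasoning
open import Relation.Nullary using (¬_; contradiction; yes; no)

open SortingAlgorithm mergeSort using (sort-↭; sort-↗)

module ⇔-Reasoning = SetoidReasoning (⇔-setoid 0ℓ)

++-split : ∀ {A : Set} (U X Y V : List A) → X ++ Y ≡ U ++ V →
           (∃[ W ] X ++ W ≡ U) ⊎ (∃[ X′ ] X ≡ U ++ X′ × X′ ++ Y ≡ V)
++-split []      X       Y V eq = inj₂ (X , refl , eq)
++-split (u ∷ U) []      Y V eq = inj₁ (u ∷ U , refl)
++-split (u ∷ U) (x ∷ X) Y V eq with Listₚ.∷-injective eq
... | refl , eq′ with ++-split U X Y V eq′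
...   | inj₁ (W , X++W≡U)               = inj₁ (W , cong (x ∷_) X++W≡U)
...   | inj₂ (X′ , X≡U++X′ , X′++Y≡V) = inj₂ (X′ , cong (x ∷_) X≡U++X′ , X′++Y≡V)

take-length-++ : ∀ {A : Set} (xs ys : List A) → take (length xs) (xs ++ ys) ≡ xs
take-length-++ []       ys = refl
take-length-++ (x ∷ xs) ys = cong (x ∷_) (take-length-++ xs ys)

drop-length-++ : ∀ {A : Set} (xs ys : List A) → drop (length xs) (xs ++ ys) ≡ ys
drop-length-++ []       ys = refl
drop-length-++ (x ∷ xs) ys = drop-length-++ xs ys

rotate-++ : ∀ {A : Set} (xs ys : List A) {k} → length ys ≡ k →
            let n = length (xs ++ ys) ℕ.∸ k in
            drop n (xs ++ ys) ++ take n (xs ++ ys) ≡ ys ++ xs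
rotate-++ xs ys refl rewrite Listₚ.length-++ xs {ys} | ℕₚ.m+n∸n≡m (length xs) (length ys) =
  cong₂ _++_ (drop-length-++ xs ys) (take-length-++ xs ys)

drop-last : ∀ {A : Set} (xs : List A) x → drop (length (xs ∷ʳ x) ℕ.∸ 1) (xs ∷ʳ x) ≡ [ x ]
drop-last xs x rewrite Listₚ.length-++ xs {[ x ]} | ℕₚ.m+n∸n≡m (length xs) 1 = drop-length-++ xs [ x ]

replicate-∷ʳ : ∀ {A : Set} n (x : A) → replicate n x ∷ʳ x ≡ replicate (suc n) x
replicate-∷ʳ zero    x = refl
replicate-∷ʳ (suc n) x = cong (x ∷_) (replicate-∷ʳ n x)

replicate-+ : ∀ {A : Set} m n (x : A) → replicate (m ℕ.+ n) x ≡ replicate m x ++ replicate n x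
replicate-+ zero    n x = refl
replicate-+ (suc m) n x = cong (x ∷_) (replicate-+ m n x)

prefix-replicate : ∀ {A : Set} {x : A} {W} X k → X ++ W ≡ replicate k x → X ≡ replicate (length X) x
prefix-replicate []      k       eq = refl
prefix-replicate (y ∷ X) (suc k) eq with Listₚ.∷-injective eq
... | refl , eq′ = cong (y ∷_) (prefix-replicate X k eq′)

reverse-replicate : ∀ {A : Set} n (x : A) → reverse (replicate n x) ≡ replicate n x
reverse-replicate zero    x = refl
reverse-replicate (suc n) x = begin
  reverse (x ∷ replicate n x)  ≡⟨ Listₚ.unfold-reverse x (replicate n x) ⟩
  reverse (replicate n x) ∷ʳ x ≡⟨ cong (_∷ʳ x) (reverse-replicate n x) ⟩
  replicate n x ∷ʳ x           ≡⟨ replicate-∷ʳ n x ⟩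
  replicate (suc n) x          ∎
  where open ≡-Reasoning

reverse-++-∷ : ∀ {A : Set} (X : List A) y Y → reverse (X ++ y ∷ Y) ≡ reverse Y ++ y ∷ reverse X
reverse-++-∷ X y Y = trans (Listₚ.reverse-++ X (y ∷ Y))
  (trans (cong (_++ reverse X) (Listₚ.unfold-reverse y Y)) (Listₚ.∷ʳ-++ (reverse Y) y (reverse X)))

reverse-++-≡ : ∀ {A : Set} (X Y : List A) {Q} → X ++ Y ≡ reverse Q → reverse Y ++ reverse X ≡ Q
reverse-++-≡ X Y {Q} eq =
  trans (sym (Listₚ.reverse-++ X Y)) (trans (cong reverse eq) (Listₚ.reverse-involutive Q))

reverse-invariant : ∀ {A B : Set} {_∙_ : B → B → B} → Commutative _≡_ _∙_ →
                    (f : List A → B) → (∀ xs ys → f (xs ++ ys) ≡ f xs ∙ f ys) →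
                    ∀ xs → f (reverse xs) ≡ f xs
reverse-invariant               comm f f-++ []       = refl
reverse-invariant {_∙_ = _∙_} comm f f-++ (x ∷ xs) = begin
  f (reverse (x ∷ xs))     ≡⟨ cong f (Listₚ.unfold-reverse x xs) ⟩
  f (reverse xs ∷ʳ x)      ≡⟨ f-++ (reverse xs) [ x ] ⟩
  f (reverse xs) ∙ f [ x ] ≡⟨ cong (_∙ f [ x ]) (reverse-invariant comm f f-++ xs) ⟩
  f xs ∙ f [ x ]           ≡⟨ comm (f xs) (f [ x ]) ⟩
  f [ x ] ∙ f xs           ≡⟨ sym (f-++ [ x ] xs) ⟩
  f (x ∷ xs)               ∎
  where open ≡-Reasoning

Linked-++⁻ˡ : ∀ {A : Set} {R : A → A → Set} X {Y} → Linked R (X ++ Y) → Linked R X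
Linked-++⁻ˡ []          _         = []
Linked-++⁻ˡ (x ∷ [])    _         = [-]
Linked-++⁻ˡ (x ∷ y ∷ X) (x~y ∷ ↗) = x~y ∷ Linked-++⁻ˡ (y ∷ X) ↗

-- Lattice paths

#E-++ : ∀ X Y → #E (X ++ Y) ≡ #E X ℕ.+ #E Y
#E-++ []      Y = refl
#E-++ (N ∷ X) Y = #E-++ X Y
#E-++ (E ∷ X) Y = cong suc (#E-++ X Y)

#N-++ : ∀ X Y → #N (X ++ Y) ≡ #N X ℕ.+ #N Y
#N-++ []      Y = refl
#N-++ (N ∷ X) Y = cong suc (#N-++ X Y)
#N-++ (E ∷ X) Y = #N-++ X Y

#N-Eᵏ : ∀ k → #N (replicate k E) ≡ 0
#N-Eᵏ zero    = refl
#N-Eᵏ (suc k) = #N-Eᵏ k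

InP-++-comm : ∀ {a b} X Y → InP a b (X ++ Y) → InP a b (Y ++ X)
InP-++-comm X Y (#E≡a , #N≡b) =
  trans (#E-++ Y X) (trans (ℕₚ.+-comm (#E Y) (#E X)) (trans (sym (#E-++ X Y)) #E≡a)) ,
  trans (#N-++ Y X) (trans (ℕₚ.+-comm (#N Y) (#N X)) (trans (sym (#N-++ X Y)) #N≡b))

InP-reverse : ∀ {a b} Q → InP a b Q → InP a b (reverse Q)
InP-reverse Q (#E≡a , #N≡b) =
  trans (reverse-invariant ℕₚ.+-comm #E #E-++ Q) #E≡a , trans (reverse-invariant ℕₚ.+-comm #N #N-++ Q) #N≡b

data LastNorth : List Step → Set where
  allEast       : ∀ k → LastNorth (replicate k E)
  northThenEast : ∀ X k → LastNorth (X ++ N ∷ replicate k E)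

lastNorth : ∀ Q → LastNorth Q
lastNorth []      = allEast 0
lastNorth (s ∷ Q) with lastNorth Q
lastNorth (N ∷ _) | allEast k         = northThenEast [] k
lastNorth (E ∷ _) | allEast k         = allEast (suc k)
lastNorth (s ∷ _) | northThenEast X k = northThenEast (s ∷ X) k

_⊕_ : ℕ × ℕ → ℕ × ℕ → ℕ × ℕ
(x , y) ⊕ (x′ , y′) = (x ℕ.+ x′ , y ℕ.+ y′)

⊕-identityʳ : ∀ p → p ⊕ (0 , 0) ≡ p
⊕-identityʳ (x , y) = cong₂ _,_ (ℕₚ.+-identityʳ x) (ℕₚ.+-identityʳ y)

length-northStartsFrom : ∀ p Q → length (northStartsFrom p Q) ≡ #N Q
length-northStartsFrom p       []      = refl
length-northStartsFrom (x , y) (N ∷ Q) = cong suc (length-northStartsFrom (x , suc y) Q)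
length-northStartsFrom (x , y) (E ∷ Q) = length-northStartsFrom (suc x , y) Q

northStartsFrom-Eᵏ : ∀ p k → northStartsFrom p (replicate k E) ≡ []
northStartsFrom-Eᵏ p       zero    = refl
northStartsFrom-Eᵏ (x , y) (suc k) = northStartsFrom-Eᵏ (suc x , y) k

northStartsFrom-last : ∀ p X k → northStartsFrom p (X ++ N ∷ replicate k E) ≡ northStartsFrom p X ∷ʳ (p ⊕ endpoint X)
northStartsFrom-last (x , y) []      k = cong₂ _∷_ (sym (⊕-identityʳ (x , y))) (northStartsFrom-Eᵏ (x , suc y) k)
northStartsFrom-last (x , y) (N ∷ X) k = cong ((x , y) ∷_) (trans (northStartsFrom-last (x , suc y) X k)
  (cong (λ y′ → northStartsFrom (x , suc y) X ∷ʳ (x ℕ.+ #E X , y′)) (sym (ℕₚ.+-suc y (#N X)))))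
northStartsFrom-last (x , y) (E ∷ X) k = trans (northStartsFrom-last (suc x , y) X k)
  (cong (λ x′ → northStartsFrom (suc x , y) X ∷ʳ (x′ , y ℕ.+ #N X)) (sym (ℕₚ.+-suc x (#E X))))

northStartsFrom-All⁻ : ∀ {P : ℕ × ℕ → Set} p X Y →
                       All P (northStartsFrom p (X ++ N ∷ Y)) → P (p ⊕ endpoint X)
northStartsFrom-All⁻ {P} p       []      Y (px ∷ _) = subst P (sym (⊕-identityʳ p)) px
northStartsFrom-All⁻ {P} (x , y) (N ∷ X) Y (_ ∷ h)  =
  subst P (cong (x ℕ.+ #E X ,_) (sym (ℕₚ.+-suc y (#N X)))) (northStartsFrom-All⁻ (x , suc y) X Y h)
northStartsFrom-All⁻ {P} (x , y) (E ∷ X) Y h        =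
  subst P (cong (_, y ℕ.+ #N X) (sym (ℕₚ.+-suc x (#E X)))) (northStartsFrom-All⁻ (suc x , y) X Y h)

northStartsFrom-All⁺ : ∀ {P : ℕ × ℕ → Set} p Q →
                       (∀ X Y → X ++ N ∷ Y ≡ Q → P (p ⊕ endpoint X)) → All P (northStartsFrom p Q)
northStartsFrom-All⁺ {P} p       []      h = []
northStartsFrom-All⁺ {P} (x , y) (N ∷ Q) h =
  subst P (⊕-identityʳ (x , y)) (h [] Q refl) ∷
  northStartsFrom-All⁺ (x , suc y) Q λ X Y eq →
    subst P (cong (x ℕ.+ #E X ,_) (ℕₚ.+-suc y (#N X))) (h (N ∷ X) Y (cong (N ∷_) eq))
northStartsFrom-All⁺ {P} (x , y) (E ∷ Q) h =
  northStartsFrom-All⁺ (suc x , y) Q λ X Y eq →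
    subst P (cong (_, y ℕ.+ #N X) (ℕₚ.+-suc x (#E X))) (h (E ∷ X) Y (cong (E ∷_) eq))

+0-shift : ∀ (p : ℤ × ℤ) → (proj₁ p ℤ.+ + 0 , proj₂ p ℤ.+ + 0) ≡ p
+0-shift (x , y) = cong₂ _,_ (ℤₚ.+-identityʳ x) (ℤₚ.+-identityʳ y)

pointsFrom-All⁻ : ∀ {P : ℤ × ℤ → Set} x y R → All P (pointsFrom (x , y) R) →
                  ∀ X Y → X ++ Y ≡ R → P (x ℤ.+ + #E X , y ℤ.+ + #N X)
pointsFrom-All⁻ {P} x y []      (px ∷ _) [] _ _ = subst P (sym (+0-shift (x , y))) px
pointsFrom-All⁻ {P} x y (N ∷ _) (px ∷ _) [] _ _ = subst P (sym (+0-shift (x , y))) px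
pointsFrom-All⁻ {P} x y (E ∷ _) (px ∷ _) [] _ _ = subst P (sym (+0-shift (x , y))) px
pointsFrom-All⁻ {P} x y (N ∷ R) (_ ∷ h) (N ∷ X) Y refl =
  subst P (cong (x ℤ.+ + #E X ,_) (ℤₚ.+-assoc y (+ 1) (+ #N X))) (pointsFrom-All⁻ x (y ℤ.+ + 1) R h X Y refl)
pointsFrom-All⁻ {P} x y (E ∷ R) (_ ∷ h) (E ∷ X) Y refl =
  subst P (cong (_, y ℤ.+ + #N X) (ℤₚ.+-assoc x (+ 1) (+ #E X))) (pointsFrom-All⁻ (x ℤ.+ + 1) y R h X Y refl)

pointsFrom-All⁺ : ∀ {P : ℤ × ℤ → Set} x y R →
                  (∀ X Y → X ++ Y ≡ R → P (x ℤ.+ + #E X , y ℤ.+ + #N X)) → All P (pointsFrom (x , y) R)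
pointsFrom-All⁺ {P} x y []      h = subst P (+0-shift (x , y)) (h [] [] refl) ∷ []
pointsFrom-All⁺ {P} x y (N ∷ R) h =
  subst P (+0-shift (x , y)) (h [] _ refl) ∷
  pointsFrom-All⁺ x (y ℤ.+ + 1) R λ X Y eq →
    subst P (cong (x ℤ.+ + #E X ,_) (sym (ℤₚ.+-assoc y (+ 1) (+ #N X)))) (h (N ∷ X) Y (cong (N ∷_) eq))
pointsFrom-All⁺ {P} x y (E ∷ R) h =
  subst P (+0-shift (x , y)) (h [] _ refl) ∷
  pointsFrom-All⁺ (x ℤ.+ + 1) y R λ X Y eq →
    subst P (cong (_, y ℤ.+ + #N X) (sym (ℤₚ.+-assoc x (+ 1) (+ #E X)))) (h (E ∷ X) Y (cong (E ∷_) eq))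

-- The constant e

a<eOf*b : ∀ a b → 1 ℕ.≤ b → a ℕ.< eOf a b ℕ.* b
a<eOf*b a (suc b) _ = begin-strict
  a                                    ≡⟨ m≡m%n+[m/n]*n a (suc b) ⟩
  a % suc b ℕ.+ (a / suc b) ℕ.* suc b  <⟨ ℕₚ.+-monoˡ-< ((a / suc b) ℕ.* suc b) (m%n<n a (suc b)) ⟩
  suc b ℕ.+ (a / suc b) ℕ.* suc b      ∎
  where open ℕₚ.≤-Reasoning

<eOf⇒*b≤a : ∀ {a b k} → 1 ℕ.≤ b → k ℕ.< eOf a b → k ℕ.* b ℕ.≤ a
<eOf⇒*b≤a {a} {suc b} {k} _ (s≤s k≤a/b) = ℕₚ.≤-trans (ℕₚ.*-monoˡ-≤ (suc b) k≤a/b) (m/n*n≤m a (suc b))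

<eOf⇒*b<a : ∀ {a b k} → Coprime a b → 1 ℕ.< b → k ℕ.< eOf a b → k ℕ.* b ℕ.< a
<eOf⇒*b<a {k = k} coprime 1<b k<e with ℕₚ.m≤n⇒m<n∨m≡n (<eOf⇒*b≤a (ℕₚ.<⇒≤ 1<b) k<e)
... | inj₁ k*b<a = k*b<a
... | inj₂ k*b≡a = contradiction (coprime (divides k (sym k*b≡a) , ∣-refl)) (ℕₚ.<⇒≢ 1<b ∘ sym)

-- Labeled paths and Q*

forget-++ : ∀ X Y → forget (X ++ Y) ≡ forget X ++ forget Y
forget-++ []         Y = refl
forget-++ (LN i ∷ X) Y = cong (N ∷_) (forget-++ X Y)
forget-++ (LE ∷ X)   Y = cong (E ∷_) (forget-++ X Y)

labels-++ : ∀ X Y → labels (X ++ Y) ≡ labels X ++ labels Y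
labels-++ []         Y = refl
labels-++ (LN i ∷ X) Y = cong (i ∷_) (labels-++ X Y)
labels-++ (LE ∷ X)   Y = labels-++ X Y

forget-map-LN : ∀ c → forget (map LN c) ≡ replicate (length c) N
forget-map-LN []      = refl
forget-map-LN (i ∷ c) = cong (N ∷_) (forget-map-LN c)

labels-map-LN : ∀ c → labels (map LN c) ≡ c
labels-map-LN []      = refl
labels-map-LN (i ∷ c) = cong (i ∷_) (labels-map-LN c)

labels-LEᵏ : ∀ k → labels (replicate k LE) ≡ []
labels-LEᵏ zero    = refl
labels-LEᵏ (suc k) = labels-LEᵏ k

shape : LStep → Step
shape (LN _) = N
shape LE     = E

forget≗map-shape : ∀ Q → forget Q ≡ map shape Q
forget≗map-shape []         = refl
forget≗map-shape (LN i ∷ Q) = cong (N ∷_) (forget≗map-shape Q)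
forget≗map-shape (LE ∷ Q)   = cong (E ∷_) (forget≗map-shape Q)

forget-lhat : ∀ e Q → forget (lhat e Q) ≡ hat e (forget Q)
forget-lhat e Q rewrite forget≗map-shape (lhat e Q) | forget≗map-shape Q | Listₚ.length-map shape Q =
  trans (Listₚ.map-++ shape (drop n Q) (take n Q)) (cong₂ _++_ (sym (Listₚ.drop-map n Q)) (sym (Listₚ.take-map n Q)))
  where n = length Q ℕ.∸ e

forget≡Eᵏ⇒ : ∀ Q k → forget Q ≡ replicate k E → Q ≡ replicate k LE
forget≡Eᵏ⇒ []         zero    _  = refl
forget≡Eᵏ⇒ (LE ∷ Q)   (suc k) eq = cong (LE ∷_) (forget≡Eᵏ⇒ Q k (Listₚ.∷-injectiveʳ eq))
forget≡Eᵏ⇒ (LN _ ∷ _) (suc k) ()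
forget≡Eᵏ⇒ (LN _ ∷ _) zero    ()
forget≡Eᵏ⇒ (LE ∷ _)   zero    ()

forget≡++Eᵏ⇒ : ∀ Q B k → forget Q ≡ B ++ replicate k E → ∃[ Q₁ ] Q ≡ Q₁ ++ replicate k LE
forget≡++Eᵏ⇒ Q          []      k eq = [] , forget≡Eᵏ⇒ Q k eq
forget≡++Eᵏ⇒ (LN i ∷ Q) (_ ∷ B) k eq with forget≡++Eᵏ⇒ Q B k (Listₚ.∷-injectiveʳ eq)
... | Q₁ , refl = LN i ∷ Q₁ , refl
forget≡++Eᵏ⇒ (LE ∷ Q)   (_ ∷ B) k eq with forget≡++Eᵏ⇒ Q B k (Listₚ.∷-injectiveʳ eq)
... | Q₁ , refl = LE ∷ Q₁ , refl

RunOrder-LE : ∀ x → RunOrder x LE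
RunOrder-LE (LN _) = ne
RunOrder-LE LE     = ee

LE∷-Linked : ∀ {Y} → Linked RunOrder Y → Linked RunOrder (LE ∷ Y)
LE∷-Linked {[]}       _  = [-]
LE∷-Linked {LN _ ∷ _} Y↗ = en ∷ Y↗
LE∷-Linked {LE ∷ _}   Y↗ = ee ∷ Y↗

LEᵏ++-Linked : ∀ k {Y} → Linked RunOrder Y → Linked RunOrder (replicate k LE ++ Y)
LEᵏ++-Linked zero    Y↗ = Y↗
LEᵏ++-Linked (suc k) Y↗ = LE∷-Linked (LEᵏ++-Linked k Y↗)

Linked-++-LE⇔ : ∀ X {Y} → Linked RunOrder (X ++ LE ∷ Y) ⇔ (Linked RunOrder X × Linked RunOrder Y)
Linked-++-LE⇔ X {Y} = mk⇔ (to X) (from X)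
  where
  to : ∀ X → Linked RunOrder (X ++ LE ∷ Y) → Linked RunOrder X × Linked RunOrder Y
  to []          ↗         = [] , Linked.tail ↗
  to (x ∷ [])    ↗         = [-] , Linked.tail (Linked.tail ↗)
  to (x ∷ y ∷ X) (x~y ∷ ↗) = let X↗ , Y↗ = to (y ∷ X) ↗ in x~y ∷ X↗ , Y↗
  from : ∀ X → Linked RunOrder X × Linked RunOrder Y → Linked RunOrder (X ++ LE ∷ Y)
  from []          (_ , Y↗)         = LE∷-Linked Y↗
  from (x ∷ [])    (_ , Y↗)         = RunOrder-LE x ∷ LE∷-Linked Y↗
  from (x ∷ y ∷ X) (x~y ∷ X↗ , Y↗) = x~y ∷ from (y ∷ X) (X↗ , Y↗)

Linked-run⇔ : ∀ c → Linked RunOrder (map LN c) ⇔ Linked ℕ._<_ c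
Linked-run⇔ c = mk⇔ (Linked.map RunOrder-LN⁻ ∘ Linkedₚ.map⁻) (Linkedₚ.map⁺ ∘ Linked.map nn)
  where
  RunOrder-LN⁻ : ∀ {i j} → RunOrder (LN i) (LN j) → i ℕ.< j
  RunOrder-LN⁻ (nn i<j) = i<j

ValidLabels-lhat : ∀ {b} k Q B → forget Q ≡ B ++ replicate k E → ValidLabels b Q → ValidLabels b (lhat k Q)
ValidLabels-lhat {b} k Q B eq (perm , Q↗) with forget≡++Eᵏ⇒ Q B k eq
... | Q₁ , refl = subst (ValidLabels b) (sym (rotate-++ Q₁ (replicate k LE) (Listₚ.length-replicate k)))
  (subst (_↭ map suc (upTo b)) same-labels perm , LEᵏ++-Linked k (Linked-++⁻ˡ Q₁ Q↗))
  where
  same-labels : labels (Q₁ ++ replicate k LE) ≡ labels (replicate k LE ++ Q₁)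
  same-labels = begin
    labels (Q₁ ++ replicate k LE)        ≡⟨ labels-++ Q₁ (replicate k LE) ⟩
    labels Q₁ ++ labels (replicate k LE) ≡⟨ cong (labels Q₁ ++_) (labels-LEᵏ k) ⟩
    labels Q₁ ++ []                      ≡⟨ Listₚ.++-identityʳ (labels Q₁) ⟩
    labels Q₁                            ≡⟨ cong (_++ labels Q₁) (sym (labels-LEᵏ k)) ⟩
    labels (replicate k LE) ++ labels Q₁ ≡⟨ sym (labels-++ (replicate k LE) Q₁) ⟩
    labels (replicate k LE ++ Q₁)        ∎
    where open ≡-Reasoning

data Runs : List LStep → Set where
  lastRun : ∀ c → Runs (map LN c)
  run     : ∀ c {Q} → Runs Q → Runs (map LN c ++ LE ∷ Q)

runs : ∀ Q → Runs Q
runs []         = lastRun []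
runs (LE ∷ Q)   = run [] (runs Q)
runs (LN i ∷ Q) with runs Q
... | lastRun c = lastRun (i ∷ c)
... | run c r   = run (i ∷ c) r

sortRunsAcc-run : ∀ acc c → sortRunsAcc acc (map LN c) ≡ map LN (sortℕ (acc ++ c))
sortRunsAcc-run acc []      = cong (map LN ∘ sortℕ) (sym (Listₚ.++-identityʳ acc))
sortRunsAcc-run acc (i ∷ c) = trans (sortRunsAcc-run (acc ++ [ i ]) c) (cong (map LN ∘ sortℕ) (Listₚ.++-assoc acc [ i ] c))

sortRunsAcc-++-LE : ∀ acc X Y → sortRunsAcc acc (X ++ LE ∷ Y) ≡ sortRunsAcc acc X ++ LE ∷ sortRuns Y
sortRunsAcc-++-LE acc []         Y = refl
sortRunsAcc-++-LE acc (LN i ∷ X) Y = sortRunsAcc-++-LE (acc ++ [ i ]) X Y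
sortRunsAcc-++-LE acc (LE ∷ X)   Y =
  trans (cong (λ T → map LN (sortℕ acc) ++ LE ∷ T) (sortRunsAcc-++-LE [] X Y))
        (sym (Listₚ.++-assoc (map LN (sortℕ acc)) (LE ∷ sortRuns X) (LE ∷ sortRuns Y)))

lstar-run : ∀ c → lstar (map LN c) ≡ map LN (sortℕ (reverse c))
lstar-run c = trans (cong sortRuns (sym (Listₚ.reverse-map LN c))) (sortRunsAcc-run [] (reverse c))

lstar-++-LE : ∀ X Y → lstar (X ++ LE ∷ Y) ≡ lstar Y ++ LE ∷ lstar X
lstar-++-LE X Y = trans (cong sortRuns (reverse-++-∷ X LE Y)) (sortRunsAcc-++-LE [] (reverse Y) (reverse X))

sortℕ-reverse-sorted : ∀ {c} → Linked ℕ._<_ c → sortℕ (reverse c) ≡ c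
sortℕ-reverse-sorted {c} c↗ = Pointwise-≡⇒≡ (↗↭↗⇒≋ ℕₚ.≤-totalOrder
  (sort-↗ (reverse c)) (Linked.map ℕₚ.<⇒≤ c↗) (↭⇒↭ₛ (↭-trans (sort-↭ (reverse c)) (↭ₚ.↭-reverse c))))

lstar-sorted-run : ∀ {c} → Linked ℕ._<_ c → lstar (map LN c) ≡ map LN c
lstar-sorted-run {c} c↗ = trans (lstar-run c) (cong (map LN) (sortℕ-reverse-sorted c↗))

forget-lstar : ∀ Q → forget (lstar Q) ≡ reverse (forget Q)
forget-lstar Q = go (runs Q)
  where
  go : ∀ {Q} → Runs Q → forget (lstar Q) ≡ reverse (forget Q)
  go (lastRun c) = begin
    forget (lstar (map LN c))                ≡⟨ cong forget (lstar-run c) ⟩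
    forget (map LN (sortℕ (reverse c)))      ≡⟨ forget-map-LN (sortℕ (reverse c)) ⟩
    replicate (length (sortℕ (reverse c))) N ≡⟨ cong (λ n → replicate n N) same-length ⟩
    replicate (length c) N                   ≡⟨ sym (reverse-replicate (length c) N) ⟩
    reverse (replicate (length c) N)         ≡⟨ cong reverse (sym (forget-map-LN c)) ⟩
    reverse (forget (map LN c))              ∎
    where
    open ≡-Reasoning
    same-length : length (sortℕ (reverse c)) ≡ length c
    same-length = trans (↭ₚ.↭-length (sort-↭ (reverse c))) (Listₚ.length-reverse c)
  go (run c {Q} r) = begin
    forget (lstar (map LN c ++ LE ∷ Q))                   ≡⟨ cong forget (lstar-++-LE (map LN c) Q) ⟩
    forget (lstar Q ++ LE ∷ lstar (map LN c))             ≡⟨ forget-++ (lstar Q) (LE ∷ lstar (map LN c)) ⟩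
    forget (lstar Q) ++ E ∷ forget (lstar (map LN c))     ≡⟨ cong₂ (λ X Y → X ++ E ∷ Y) (go r) (go (lastRun c)) ⟩
    reverse (forget Q) ++ E ∷ reverse (forget (map LN c)) ≡⟨ sym (reverse-++-∷ (forget (map LN c)) E (forget Q)) ⟩
    reverse (forget (map LN c) ++ E ∷ forget Q)           ≡⟨ cong reverse (sym (forget-++ (map LN c) (LE ∷ Q))) ⟩
    reverse (forget (map LN c ++ LE ∷ Q))                 ∎
    where open ≡-Reasoning

labels-lstar : ∀ Q → labels (lstar Q) ↭ labels Q
labels-lstar Q = go (runs Q)
  where
  go : ∀ {Q} → Runs Q → labels (lstar Q) ↭ labels Q
  go (lastRun c)   = subst₂ _↭_ (sym (trans (cong labels (lstar-run c)) (labels-map-LN _))) (sym (labels-map-LN c))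
    (↭-trans (sort-↭ (reverse c)) (↭ₚ.↭-reverse c))
  go (run c {Q} r) = subst₂ _↭_
    (sym (trans (cong labels (lstar-++-LE (map LN c) Q)) (labels-++ (lstar Q) (LE ∷ lstar (map LN c)))))
    (sym (labels-++ (map LN c) (LE ∷ Q)))
    (↭-trans (↭ₚ.++⁺ (go r) (go (lastRun c))) (↭ₚ.++-comm (labels Q) (labels (map LN c))))

lstar-Linked : ∀ Q → Linked RunOrder Q → Linked RunOrder (lstar Q)
lstar-Linked Q = go (runs Q)
  where
  go : ∀ {Q} → Runs Q → Linked RunOrder Q → Linked RunOrder (lstar Q)
  go (lastRun c)   c↗ = subst (Linked RunOrder) (sym (lstar-sorted-run (Equivalence.to (Linked-run⇔ c) c↗))) c↗
  go (run c {Q} r) ↗  =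
    let c↗ , Q↗ = Equivalence.to (Linked-++-LE⇔ (map LN c)) ↗
    in subst (Linked RunOrder) (sym (lstar-++-LE (map LN c) Q))
         (Equivalence.from (Linked-++-LE⇔ (lstar Q)) (go r Q↗ , go (lastRun c) c↗))

lstar-involutive : ∀ Q → Linked RunOrder Q → lstar (lstar Q) ≡ Q
lstar-involutive Q = go (runs Q)
  where
  go : ∀ {Q} → Runs Q → Linked RunOrder Q → lstar (lstar Q) ≡ Q
  go (lastRun c)   c↗ = trans (cong lstar fixed) fixed
    where fixed = lstar-sorted-run (Equivalence.to (Linked-run⇔ c) c↗)
  go (run c {Q} r) ↗  = begin
    lstar (lstar (map LN c ++ LE ∷ Q))               ≡⟨ cong lstar (lstar-++-LE (map LN c) Q) ⟩
    lstar (lstar Q ++ LE ∷ lstar (map LN c))         ≡⟨ lstar-++-LE (lstar Q) (lstar (map LN c)) ⟩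
    lstar (lstar (map LN c)) ++ LE ∷ lstar (lstar Q) ≡⟨ cong₂ (λ X Y → X ++ LE ∷ Y) (go (lastRun c) c↗) (go r Q↗) ⟩
    map LN c ++ LE ∷ Q                               ∎
    where
    open ≡-Reasoning
    c↗ = proj₁ (Equivalence.to (Linked-++-LE⇔ (map LN c)) ↗)
    Q↗ = proj₂ (Equivalence.to (Linked-++-LE⇔ (map LN c)) ↗)

ValidLabels-lstar : ∀ b Q → ValidLabels b Q → ValidLabels b (lstar Q)
ValidLabels-lstar b Q (perm , Q↗) = ↭-trans (labels-lstar Q) perm , lstar-Linked Q Q↗

-- Heights and skeletal paths

module Paths (a b : ℕ) where

  open import Data.Integer using (_+_; _*_; _≤_; _<_)
  open import Data.Integer.Properties

  height : List Step → ℤ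
  height []      = + 0
  height (N ∷ s) = + a + height s
  height (E ∷ s) = - + b + height s

  level-endpoint : ∀ X → level a b (endpoint X) ≡ height X
  level-endpoint []      = cong₂ (λ m n → + m - + n) (ℕₚ.*-zeroʳ a) (ℕₚ.*-zeroʳ b)
  level-endpoint (N ∷ X) = begin
    + (a ℕ.* suc (#N X)) - + (b ℕ.* #E X)   ≡⟨ cong (λ m → + m - + (b ℕ.* #E X)) (ℕₚ.*-suc a (#N X)) ⟩
    + (a ℕ.+ a ℕ.* #N X) - + (b ℕ.* #E X)   ≡⟨ cong (_- + (b ℕ.* #E X)) (pos-+ a (a ℕ.* #N X)) ⟩
    (+ a + + (a ℕ.* #N X)) - + (b ℕ.* #E X) ≡⟨ +-assoc (+ a) (+ (a ℕ.* #N X)) (- + (b ℕ.* #E X)) ⟩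
    + a + level a b (endpoint X)            ≡⟨ cong (λ h → + a + h) (level-endpoint X) ⟩
    + a + height X                          ∎
    where open ≡-Reasoning
  level-endpoint (E ∷ X) = begin
    + (a ℕ.* #N X) - + (b ℕ.* suc (#E X))    ≡⟨ cong (λ m → + (a ℕ.* #N X) - + m) (ℕₚ.*-suc b (#E X)) ⟩
    + (a ℕ.* #N X) - + (b ℕ.+ b ℕ.* #E X)    ≡⟨ cong (λ h → + (a ℕ.* #N X) - h) (pos-+ b (b ℕ.* #E X)) ⟩
    + (a ℕ.* #N X) - (+ b + + (b ℕ.* #E X)) ≡⟨ exchange (+ (a ℕ.* #N X)) (+ b) (+ (b ℕ.* #E X)) ⟩
    - + b + level a b (endpoint X)           ≡⟨ cong (λ h → - + b + h) (level-endpoint X) ⟩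
    - + b + height X                         ∎
    where
    open ≡-Reasoning
    exchange : ∀ x y z → x - (y + z) ≡ - y + (x - z)
    exchange = solve-∀

  NonNegLevel-endpoint : ∀ X → NonNegLevel a b (endpoint X) ≡ (+ 0 ≤ height X)
  NonNegLevel-endpoint X = cong (+ 0 ≤_) (level-endpoint X)

  height-++ : ∀ X Y → height (X ++ Y) ≡ height X + height Y
  height-++ []      Y = sym (+-identityˡ (height Y))
  height-++ (N ∷ X) Y = trans (cong (λ h → + a + h) (height-++ X Y)) (sym (+-assoc (+ a) (height X) (height Y)))
  height-++ (E ∷ X) Y = trans (cong (λ h → - + b + h) (height-++ X Y)) (sym (+-assoc (- + b) (height X) (height Y)))

  height-reverse : ∀ X → height (reverse X) ≡ height X
  height-reverse = reverse-invariant +-comm height height-++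

  height-Eᵏ : ∀ k → height (replicate k E) ≡ - + (k ℕ.* b)
  height-Eᵏ zero    = refl
  height-Eᵏ (suc k) = begin
    - + b + height (replicate k E) ≡⟨ cong (λ h → - + b + h) (height-Eᵏ k) ⟩
    - + b + - + (k ℕ.* b)          ≡⟨ sym (neg-distrib-+ (+ b) (+ (k ℕ.* b))) ⟩
    - (+ b + + (k ℕ.* b))          ≡⟨ cong -_ (sym (pos-+ b (k ℕ.* b))) ⟩
    - + (b ℕ.+ k ℕ.* b)            ∎
    where open ≡-Reasoning

  height-++-Eᵏ : ∀ X k → height (X ++ replicate k E) ≤ height X
  height-++-Eᵏ X k = begin
    height (X ++ replicate k E)       ≡⟨ height-++ X (replicate k E) ⟩
    height X + height (replicate k E) ≡⟨ cong (λ h → height X + h) (height-Eᵏ k) ⟩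
    height X - + (k ℕ.* b)            ≤⟨ i-j≤i (height X) (+ (k ℕ.* b)) ⟩
    height X                          ∎
    where open ≤-Reasoning

  height-Eᵏ≤0 : ∀ k → height (replicate k E) ≤ + 0
  height-Eᵏ≤0 = height-++-Eᵏ []

  height-prefix-Eᵏ : ∀ X {W} k → X ++ W ≡ replicate k E → height X ≤ + 0
  height-prefix-Eᵏ X k eq = subst (λ X → height X ≤ + 0) (sym (prefix-replicate X k eq)) (height-Eᵏ≤0 (length X))

  Eᵏ++-height≤0⇔ : ∀ k X → (height (replicate k E ++ X) ≤ + 0) ⇔ (height X ≤ + (k ℕ.* b))
  Eᵏ++-height≤0⇔ k X =
    subst (λ h → (h ≤ + 0) ⇔ (height X ≤ + (k ℕ.* b))) (sym height-Eᵏ++) (mk⇔ i-j≤0⇒i≤j i≤j⇒i-j≤0)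
    where
    height-Eᵏ++ : height (replicate k E ++ X) ≡ height X - + (k ℕ.* b)
    height-Eᵏ++ = trans (height-++ (replicate k E) X)
      (trans (cong (_+ height X) (height-Eᵏ k)) (+-comm (- + (k ℕ.* b)) (height X)))

  height-peak : ∀ X k → height (X ++ N ∷ replicate k E) ≡ (height X + + a) - + (k ℕ.* b)
  height-peak X k = begin
    height (X ++ N ∷ replicate k E)           ≡⟨ height-++ X (N ∷ replicate k E) ⟩
    height X + (+ a + height (replicate k E)) ≡⟨ cong (λ h → height X + (+ a + h)) (height-Eᵏ k) ⟩
    height X + (+ a - + (k ℕ.* b))            ≡⟨ sym (+-assoc (height X) (+ a) (- + (k ℕ.* b))) ⟩
    (height X + + a) - + (k ℕ.* b)            ∎
    where open ≡-Reasoning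

  InP⇒height≡0 : ∀ Q → InP a b Q → height Q ≡ + 0
  InP⇒height≡0 Q (#E≡a , #N≡b) = begin
    height Q                        ≡⟨ sym (level-endpoint Q) ⟩
    + (a ℕ.* #N Q) - + (b ℕ.* #E Q) ≡⟨ cong₂ (λ n m → + (a ℕ.* n) - + (b ℕ.* m)) #N≡b #E≡a ⟩
    + (a ℕ.* b) - + (b ℕ.* a)       ≡⟨ cong (λ n → + (a ℕ.* b) - + n) (ℕₚ.*-comm b a) ⟩
    + (a ℕ.* b) - + (a ℕ.* b)       ≡⟨ +-inverseʳ (+ (a ℕ.* b)) ⟩
    + 0                             ∎
    where open ≡-Reasoning

  height-complement : ∀ P S {Q} → height Q ≡ + 0 → P ++ S ≡ Q → height S ≡ - height P
  height-complement P S h≡0 refl = begin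
    height S                           ≡⟨ cancel (height P) (height S) ⟩
    - height P + (height P + height S) ≡⟨ cong (λ h → - height P + h) (trans (sym (height-++ P S)) h≡0) ⟩
    - height P + + 0                   ≡⟨ +-identityʳ (- height P) ⟩
    - height P                         ∎
    where
    open ≡-Reasoning
    cancel : ∀ x y → y ≡ - x + (x + y)
    cancel = solve-∀

  height-rotation : ∀ {Q} X k S → InP a b Q → X ++ N ∷ replicate k E ++ S ≡ Q → height (S ++ X) ≡ + (k ℕ.* b) - + a
  height-rotation {Q} X k S inP eq = begin
    height (S ++ X)                               ≡⟨ height-++ S X ⟩
    height S + height X                           ≡⟨ cong (_+ height X) (height-complement (X ++ N ∷ replicate k E) S
                                                       (InP⇒height≡0 Q inP) (trans (Listₚ.++-assoc X _ S) eq)) ⟩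
    - height (X ++ N ∷ replicate k E) + height X  ≡⟨ cong (λ h → - h + height X) (height-peak X k) ⟩
    - ((height X + + a) - + (k ℕ.* b)) + height X ≡⟨ cancel (height X) (+ a) (+ (k ℕ.* b)) ⟩
    + (k ℕ.* b) - + a                             ∎
    where
    open ≡-Reasoning
    cancel : ∀ h a kb → - ((h + a) - kb) + h ≡ kb - a
    cancel = solve-∀

  x≤x+y : ∀ x {y} → + 0 ≤ y → x ≤ x + y
  x≤x+y x {y} 0≤y = subst (_≤ x + y) (+-identityʳ x) (+-monoʳ-≤ x 0≤y)

  0<y-x : ∀ {x y} → x < y → + 0 < y - x
  0<y-x {x} {y} x<y = subst (_< y - x) (+-inverseʳ x) (+-monoˡ-< (- x) x<y)

  0≤m-n⇔n≤m : ∀ m n → (+ 0 ≤ + m - + n) ⇔ (n ℕ.≤ m)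
  0≤m-n⇔n≤m m n = mk⇔ (drop‿+≤+ ∘ 0≤i-j⇒j≤i) (i≤j⇒0≤j-i ∘ +≤+)

  NonNegPrefixes NonPosPrefixes : List Step → Set
  NonNegPrefixes Q = ∀ X Y → X ++ Y ≡ Q → + 0 ≤ height X
  NonPosPrefixes Q = ∀ X Y → X ++ Y ≡ Q → height X ≤ + 0

  IsDyck⇔ : ∀ Q → IsDyck a b Q ⇔ (InP a b Q × NonNegPrefixes Q)
  IsDyck⇔ Q = mk⇔ (λ (inP , starts) → inP , λ X Y → nonNeg inP starts Y X) from
    where
    nonNeg : InP a b Q → All (NonNegLevel a b) (northStarts Q) → ∀ Y X → X ++ Y ≡ Q → + 0 ≤ height X
    nonNeg inP starts []      X eq   =
      ≤-reflexive (sym (trans (cong height (trans (sym (Listₚ.++-identityʳ X)) eq)) (InP⇒height≡0 Q inP)))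
    nonNeg inP starts (N ∷ Y) X refl = subst id (NonNegLevel-endpoint X) (northStartsFrom-All⁻ (0 , 0) X Y starts)
    nonNeg inP starts (E ∷ Y) X eq   =
      ≤-trans (nonNeg inP starts Y (X ++ [ E ]) (trans (Listₚ.++-assoc X [ E ] Y) eq)) (height-++-Eᵏ X 1)
    from : InP a b Q × NonNegPrefixes Q → IsDyck a b Q
    from (inP , nonNeg) = inP , northStartsFrom-All⁺ (0 , 0) Q λ X Y eq →
      subst id (sym (NonNegLevel-endpoint X)) (nonNeg X (N ∷ Y) eq)

  e : ℕ
  e = eOf a b

  prefix-#E≤ : ∀ X {Y R} → InP a b R → X ++ Y ≡ R → #E X ℕ.≤ a
  prefix-#E≤ X {Y} (#E≡a , _) refl = subst (#E X ℕ.≤_) (trans (sym (#E-++ X Y)) #E≡a) (ℕₚ.m≤m+n (#E X) (#E Y))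

  IsInvDyck⇔ : ∀ R → IsInvDyck a b R ⇔ (InP a b R × NonPosPrefixes R)
  IsInvDyck⇔ R = mk⇔ to from
    where
    below-diagonal : ∀ X → (+ a * + #N X ≤ + b * ((- + e + + #E X) + + e)) ≡ (+ (a ℕ.* #N X) ≤ + (b ℕ.* #E X))
    below-diagonal X = cong₂ _≤_ (sym (pos-* a (#N X))) (trans (cong (+ b *_) (shift (+ #E X) (+ e))) (sym (pos-* b (#E X))))
      where
      shift : ∀ x y → (- y + x) + y ≡ x
      shift = solve-∀
    to : IsInvDyck a b R → InP a b R × NonPosPrefixes R
    to (inP , points) = inP , λ X Y eq →
      let (_ , _ , cross) = pointsFrom-All⁻ (- + e) (+ 0) R points X Y eq
      in subst (_≤ + 0) (level-endpoint X) (i≤j⇒i-j≤0 (subst id (below-diagonal X) cross))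
    from : InP a b R × NonPosPrefixes R → IsInvDyck a b R
    from (inP , nonPos) = inP , pointsFrom-All⁺ (- + e) (+ 0) R λ X Y eq →
      +≤+ z≤n ,
      subst (_≤ + a - + e) (+-comm (+ #E X) (- + e)) (+-monoˡ-≤ (- + e) (+≤+ (prefix-#E≤ X inP eq))) ,
      subst id (sym (below-diagonal X)) (i-j≤0⇒i≤j (subst (_≤ + 0) (sym (level-endpoint X)) (nonPos X Y eq)))

  height-prefix-reverse : ∀ Q X Y → InP a b Q → X ++ Y ≡ reverse Q → height X ≡ - height (reverse Y)
  height-prefix-reverse Q X Y inP eq = trans (sym (height-reverse X))
    (height-complement (reverse Y) (reverse X) (InP⇒height≡0 Q inP) (reverse-++-≡ X Y {Q} eq))

  Dyck⇒InvDyck-reverse : ∀ Q → IsDyck a b Q → IsInvDyck a b (reverse Q)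
  Dyck⇒InvDyck-reverse Q dyck with Equivalence.to (IsDyck⇔ Q) dyck
  ... | inP , nonNeg = Equivalence.from (IsInvDyck⇔ (reverse Q)) (InP-reverse Q inP , λ X Y eq →
    subst (_≤ + 0) (sym (height-prefix-reverse Q X Y inP eq)) (neg-mono-≤ (nonNeg (reverse Y) (reverse X) (reverse-++-≡ X Y eq))))

  InvDyck⇒Dyck-reverse : ∀ R → IsInvDyck a b R → IsDyck a b (reverse R)
  InvDyck⇒Dyck-reverse R inv with Equivalence.to (IsInvDyck⇔ R) inv
  ... | inP , nonPos = Equivalence.from (IsDyck⇔ (reverse R)) (InP-reverse R inP , λ X Y eq →
    subst (+ 0 ≤_) (sym (height-prefix-reverse R X Y inP eq)) (neg-mono-≤ (nonPos (reverse Y) (reverse X) (reverse-++-≡ X Y eq))))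

  UnstableRotations : ℕ → List Step → Set
  UnstableRotations k Q = ∀ P S → P ++ S ≡ Q → + 0 < height P → ¬ KStable a b k (S ++ P)

  KSkeletal⇔ : ∀ k Q → KSkeletal a b k Q ⇔ (KStable a b k Q × UnstableRotations k Q)
  KSkeletal⇔ k Q = mk⇔ (λ (stable , skeletal) → stable , unstable skeletal) λ (stable , unstable) →
    stable , λ i _ 0<level →
      unstable (take i Q) (drop i Q) (Listₚ.take++drop≡id i Q) (subst (+ 0 <_) (level-endpoint (take i Q)) 0<level)
    where
    unstable : (∀ i → i ℕ.≤ length Q → + 0 < level a b (endpoint (take i Q)) → ¬ KStable a b k (rotate i Q)) →
               UnstableRotations k Q
    unstable skeletal P S refl 0<height =
      skeletal (length P) (Listₚ.length-++-≤ˡ P)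
        (subst (λ X → + 0 < level a b (endpoint X)) (sym (take-length-++ P S)) (subst (+ 0 <_) (sym (level-endpoint P)) 0<height))
      ∘ subst (KStable a b k) (sym (cong₂ _++_ (drop-length-++ P S) (take-length-++ P S)))

  KStable[b∸1]≡All : ∀ Q → #N Q ≡ b → KStable a b (b ℕ.∸ 1) Q ≡ All (NonNegLevel a b) (northStarts Q)
  KStable[b∸1]≡All Q #N≡b = cong (λ n → All (NonNegLevel a b) (drop n (northStarts Q)))
    (trans (cong (λ n → n ℕ.∸ suc (b ℕ.∸ 1)) (trans (length-northStartsFrom (0 , 0) Q) #N≡b))
           (ℕₚ.m≤n⇒m∸n≡0 (ℕₚ.m≤n+m∸n b 1)))

  skeletal⇔Dyck : ∀ {Q} → InP a b Q → KSkeletal a b (b ℕ.∸ 1) Q ⇔ IsDyck a b Q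
  skeletal⇔Dyck {Q} inP = mk⇔ (λ (stable , _) → inP , subst id (KStable[b∸1]≡All Q (proj₂ inP)) stable) λ dyck →
    Equivalence.from (KSkeletal⇔ (b ℕ.∸ 1) Q) (subst id (sym (KStable[b∸1]≡All Q (proj₂ inP))) (proj₂ dyck) , unstable)
    where
    unstable : UnstableRotations (b ℕ.∸ 1) Q
    unstable P S refl 0<height stable = <-irrefl refl (begin-strict
      + 0        ≤⟨ proj₂ (Equivalence.to (IsDyck⇔ (S ++ P)) rotated-Dyck) S P refl ⟩
      height S   ≡⟨ height-complement P S (InP⇒height≡0 Q inP) refl ⟩
      - height P <⟨ neg-mono-< 0<height ⟩
      + 0        ∎)
      where
      open ≤-Reasoning
      rotated-Dyck : IsDyck a b (S ++ P)
      rotated-Dyck = InP-++-comm P S inP , subst id (KStable[b∸1]≡All (S ++ P) (proj₂ (InP-++-comm P S inP))) stable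

  KStable₀-lastNorth⇔ : ∀ X k → KStable a b 0 (X ++ N ∷ replicate k E) ⇔ (+ 0 ≤ height X)
  KStable₀-lastNorth⇔ X k = subst (_⇔ (+ 0 ≤ height X)) (sym last-start)
    (mk⇔ (subst id (NonNegLevel-endpoint X) ∘ Allₚ.singleton⁻) ((_∷ []) ∘ subst id (sym (NonNegLevel-endpoint X))))
    where
    last-start : KStable a b 0 (X ++ N ∷ replicate k E) ≡ All (NonNegLevel a b) [ endpoint X ]
    last-start = trans (cong (λ ns → All (NonNegLevel a b) (drop (length ns ℕ.∸ 1) ns)) (northStartsFrom-last (0 , 0) X k))
                       (cong (All (NonNegLevel a b)) (drop-last (northStarts X) (endpoint X)))

  rotation-stable⇔ : ∀ {Q} X k S → InP a b Q → X ++ N ∷ replicate k E ++ S ≡ Q →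
                     KStable a b 0 (S ++ X ++ N ∷ replicate k E) ⇔ a ℕ.≤ k ℕ.* b
  rotation-stable⇔ X k S inP eq = begin
    KStable a b 0 (S ++ X ++ N ∷ replicate k E)   ≡⟨ cong (KStable a b 0) (sym (Listₚ.++-assoc S X (N ∷ replicate k E))) ⟩
    KStable a b 0 ((S ++ X) ++ N ∷ replicate k E) ≈⟨ KStable₀-lastNorth⇔ (S ++ X) k ⟩
    + 0 ≤ height (S ++ X)                         ≡⟨ cong (+ 0 ≤_) (height-rotation X k S inP eq) ⟩
    + 0 ≤ + (k ℕ.* b) - + a                       ≈⟨ 0≤m-n⇔n≤m (k ℕ.* b) a ⟩
    a ℕ.≤ k ℕ.* b                                 ∎
    where open ⇔-Reasoning

  -- Only rotations just after a north step followed by at least e east steps can be 0-stable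
  -- (see rotation-stable⇔), so 0-skeletality only constrains the height at the top of such
  -- north steps.
  PeaksBounded Bounded : List Step → Set
  PeaksBounded Q = ∀ X S → X ++ N ∷ replicate e E ++ S ≡ Q → height X + + a ≤ + (e ℕ.* b)
  Bounded Q      = ∀ X Y → X ++ Y ≡ Q → height X ≤ + (e ℕ.* b)

  peak-Eᵏ-split : ∀ {X S k} → e ℕ.≤ k →
                  X ++ N ∷ replicate k E ++ S ≡ X ++ N ∷ replicate e E ++ replicate (k ℕ.∸ e) E ++ S
  peak-Eᵏ-split {X} {S} {k} e≤k = cong (λ T → X ++ N ∷ T) (begin
    replicate k E ++ S                            ≡⟨ cong (λ n → replicate n E ++ S) (sym (ℕₚ.m+[n∸m]≡n e≤k)) ⟩
    replicate (e ℕ.+ (k ℕ.∸ e)) E ++ S            ≡⟨ cong (_++ S) (replicate-+ e (k ℕ.∸ e) E) ⟩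
    (replicate e E ++ replicate (k ℕ.∸ e) E) ++ S ≡⟨ Listₚ.++-assoc (replicate e E) _ S ⟩
    replicate e E ++ replicate (k ℕ.∸ e) E ++ S   ∎)
    where open ≡-Reasoning

  bounded⇒peaksBounded : ∀ {Q} → Bounded Q → PeaksBounded Q
  bounded⇒peaksBounded bounded X S eq =
    subst (_≤ + (e ℕ.* b)) (trans (height-++ X [ N ]) (cong (λ h → height X + h) (+-identityʳ (+ a))))
      (bounded (X ++ [ N ]) (replicate e E ++ S) (trans (Listₚ.++-assoc X [ N ] _) eq))

  bounded⇔hat-nonPos : ∀ B → Bounded (B ++ replicate e E) ⇔ NonPosPrefixes (replicate e E ++ B)
  bounded⇔hat-nonPos B = mk⇔ to from
    where
    to : Bounded (B ++ replicate e E) → NonPosPrefixes (replicate e E ++ B)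
    to bounded X Y eq with ++-split (replicate e E) X Y B eq
    ... | inj₁ (W , X++W≡Eᵉ)         = height-prefix-Eᵏ X e X++W≡Eᵉ
    ... | inj₂ (X′ , refl , X′++Y≡B) = Equivalence.from (Eᵏ++-height≤0⇔ e X′)
      (bounded X′ (Y ++ replicate e E) (trans (sym (Listₚ.++-assoc X′ Y _)) (cong (_++ replicate e E) X′++Y≡B)))
    from : NonPosPrefixes (replicate e E ++ B) → Bounded (B ++ replicate e E)
    from nonPos P S eq with ++-split B P S (replicate e E) eq
    ... | inj₁ (W , P++W≡B)          = Equivalence.to (Eᵏ++-height≤0⇔ e P)
      (nonPos (replicate e E ++ P) W (trans (Listₚ.++-assoc (replicate e E) P W) (cong (replicate e E ++_) P++W≡B)))
    ... | inj₂ (P′ , refl , P′++S≡Eᵉ) = begin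
      height (B ++ P′)     ≡⟨ height-++ B P′ ⟩
      height B + height P′ ≤⟨ +-mono-≤ B≤eb (height-prefix-Eᵏ P′ e P′++S≡Eᵉ) ⟩
      + (e ℕ.* b) + + 0    ≡⟨ +-identityʳ (+ (e ℕ.* b)) ⟩
      + (e ℕ.* b)          ∎
      where
      open ≤-Reasoning
      B≤eb : height B ≤ + (e ℕ.* b)
      B≤eb = Equivalence.to (Eᵏ++-height≤0⇔ e B) (nonPos (replicate e E ++ B) [] (Listₚ.++-identityʳ _))

  labeled-skeletal⇔Dyck : ∀ Q → IsLabeledPath a b Q → KSkeletal a b (b ℕ.∸ 1) (forget Q) ⇔ IsLabeledDyck a b Q
  labeled-skeletal⇔Dyck Q (inP , valid) =
    mk⇔ ((_, valid) ∘ Equivalence.to (skeletal⇔Dyck inP)) (Equivalence.from (skeletal⇔Dyck inP) ∘ proj₁)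

  labeledDyck⇒InvDyck-lstar : ∀ Q → IsLabeledDyck a b Q → IsLabeledInvDyck a b (lstar Q)
  labeledDyck⇒InvDyck-lstar Q (dyck , valid) =
    subst (IsInvDyck a b) (sym (forget-lstar Q)) (Dyck⇒InvDyck-reverse (forget Q) dyck) , ValidLabels-lstar b Q valid

  lstar-injective : ∀ Q Q′ → IsLabeledDyck a b Q → IsLabeledDyck a b Q′ → lstar Q ≡ lstar Q′ → Q ≡ Q′
  lstar-injective Q Q′ (_ , _ , Q↗) (_ , _ , Q′↗) eq =
    trans (sym (lstar-involutive Q Q↗)) (trans (cong lstar eq) (lstar-involutive Q′ Q′↗))

  lstar-surjective : ∀ R → IsLabeledInvDyck a b R → ∃[ Q ] (IsLabeledDyck a b Q × lstar Q ≡ R)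
  lstar-surjective R (inv , valid) =
    lstar R ,
    (subst (IsDyck a b) (sym (forget-lstar R)) (InvDyck⇒Dyck-reverse (forget R) inv) , ValidLabels-lstar b R valid) ,
    lstar-involutive R (proj₂ valid)

  module _ (coprime : Coprime a b) (1<b : 1 ℕ.< b) where

    stable⇒e≤k : ∀ {Q} X k S → InP a b Q → X ++ N ∷ replicate k E ++ S ≡ Q →
                 KStable a b 0 (S ++ X ++ N ∷ replicate k E) → e ℕ.≤ k
    stable⇒e≤k X k S inP eq stable = ℕₚ.≮⇒≥ λ k<e →
      ℕₚ.<⇒≱ (<eOf⇒*b<a coprime 1<b k<e) (Equivalence.to (rotation-stable⇔ X k S inP eq) stable)

    stable⇒Eᵉ-suffix : ∀ Q → InP a b Q → KStable a b 0 Q → ∃[ B ] Q ≡ B ++ replicate e E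
    stable⇒Eᵉ-suffix Q inP stable with lastNorth Q
    ... | allEast k         =
      contradiction (trans (sym (proj₂ inP)) (#N-Eᵏ k)) (ℕₚ.<⇒≢ (ℕₚ.<-trans ℕₚ.0<1+n 1<b) ∘ sym)
    ... | northThenEast X k = X ++ N ∷ replicate (k ℕ.∸ e) E , (begin
      X ++ N ∷ replicate k E                            ≡⟨ cong (λ n → X ++ N ∷ replicate n E) (sym (ℕₚ.m∸n+n≡m e≤k)) ⟩
      X ++ N ∷ replicate (k ℕ.∸ e ℕ.+ e) E             ≡⟨ cong (λ T → X ++ N ∷ T) (replicate-+ (k ℕ.∸ e) e E) ⟩
      X ++ N ∷ replicate (k ℕ.∸ e) E ++ replicate e E   ≡⟨ sym (Listₚ.++-assoc X _ (replicate e E)) ⟩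
      (X ++ N ∷ replicate (k ℕ.∸ e) E) ++ replicate e E ∎)
      where
      open ≡-Reasoning
      e≤k : e ℕ.≤ k
      e≤k = stable⇒e≤k X k [] inP (cong (λ T → X ++ N ∷ T) (Listₚ.++-identityʳ _)) stable

    unstable⇔peaksBounded : ∀ {Q} → InP a b Q → UnstableRotations 0 Q ⇔ PeaksBounded Q
    unstable⇔peaksBounded {Q} inP = mk⇔ to from
      where
      to : UnstableRotations 0 Q → PeaksBounded Q
      to unstable X S eq = ≮⇒≥ λ eb<peak →
        unstable (X ++ N ∷ replicate e E) S (trans (Listₚ.++-assoc X _ S) eq)
          (subst (+ 0 <_) (sym (height-peak X e)) (0<y-x eb<peak))
          (Equivalence.from (rotation-stable⇔ X e S inP eq) (ℕₚ.<⇒≤ (a<eOf*b a b (ℕₚ.<⇒≤ 1<b))))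
      from : PeaksBounded Q → UnstableRotations 0 Q
      from peaks P S eq 0<height stable with lastNorth P
      ... | allEast m         = <⇒≱ 0<height (height-Eᵏ≤0 m)
      ... | northThenEast X k = <⇒≱ 0<height (begin
        height (X ++ N ∷ replicate k E) ≡⟨ height-peak X k ⟩
        (height X + + a) - + (k ℕ.* b)  ≤⟨ +-monoˡ-≤ (- + (k ℕ.* b)) (peaks X _ (trans (sym (peak-Eᵏ-split e≤k)) eq′)) ⟩
        + (e ℕ.* b) - + (k ℕ.* b)       ≤⟨ i≤j⇒i-j≤0 (+≤+ (ℕₚ.*-monoˡ-≤ b e≤k)) ⟩
        + 0                             ∎)
        where
        open ≤-Reasoning
        eq′ : X ++ N ∷ replicate k E ++ S ≡ Q
        eq′ = trans (sym (Listₚ.++-assoc X _ S)) eq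
        e≤k : e ℕ.≤ k
        e≤k = stable⇒e≤k X k S inP eq′ stable

    -- Walk forward from a north step: if fewer than e east steps follow before the next north
    -- step, the height at the top of that next step is larger (j b < a), so it suffices to
    -- bound the latter; the walk ends at a north step followed by e east steps, or at the end
    -- of Q, where the height is 0.
    peak-bound : ∀ {Q} → InP a b Q → PeaksBounded Q →
                 ∀ S X j → X ++ N ∷ replicate j E ++ S ≡ Q → height X + + a ≤ + (e ℕ.* b)
    peak-bound inP peaks S X j eq with e ℕ.≤? j
    peak-bound inP peaks S X j eq | yes e≤j = peaks X _ (trans (sym (peak-Eᵏ-split e≤j)) eq)
    peak-bound inP peaks [] X j eq | no e≰j = begin
      height X + + a ≡⟨ i-j≡0⇒i≡j _ _ (trans (sym (height-peak X j)) (InP⇒height≡0 (X ++ N ∷ replicate j E) inP′)) ⟩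
      + (j ℕ.* b)    ≤⟨ +≤+ (ℕₚ.*-monoˡ-≤ b (ℕₚ.<⇒≤ (ℕₚ.≰⇒> e≰j))) ⟩
      + (e ℕ.* b)    ∎
      where
      open ≤-Reasoning
      inP′ : InP a b (X ++ N ∷ replicate j E)
      inP′ = subst (InP a b) (sym (trans (cong (λ T → X ++ N ∷ T) (sym (Listₚ.++-identityʳ _))) eq)) inP
    peak-bound inP peaks (E ∷ S) X j eq | no _ = peak-bound inP peaks S X (suc j) (trans (cong (λ T → X ++ N ∷ T) Eʲ⁺¹) eq)
      where
      Eʲ⁺¹ : replicate (suc j) E ++ S ≡ replicate j E ++ E ∷ S
      Eʲ⁺¹ = trans (cong (_++ S) (sym (replicate-∷ʳ j E))) (Listₚ.∷ʳ-++ (replicate j E) E S)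
    peak-bound inP peaks (N ∷ S) X j eq | no e≰j = begin
      height X + + a                         ≤⟨ x≤x+y (height X + + a) 0≤a-jb ⟩
      (height X + + a) + (+ a - + (j ℕ.* b)) ≡⟨ swap (height X + + a) (+ a) (+ (j ℕ.* b)) ⟩
      ((height X + + a) - + (j ℕ.* b)) + + a ≡⟨ cong (_+ + a) (sym (height-peak X j)) ⟩
      height (X ++ N ∷ replicate j E) + + a  ≤⟨ peak-bound inP peaks S (X ++ N ∷ replicate j E) 0 eq′ ⟩
      + (e ℕ.* b)                            ∎
      where
      open ≤-Reasoning
      eq′ : (X ++ N ∷ replicate j E) ++ N ∷ S ≡ _
      eq′ = trans (Listₚ.++-assoc X _ (N ∷ S)) eq
      0≤a-jb : + 0 ≤ + a - + (j ℕ.* b)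
      0≤a-jb = Equivalence.from (0≤m-n⇔n≤m a (j ℕ.* b)) (<eOf⇒*b≤a (ℕₚ.<⇒≤ 1<b) (ℕₚ.≰⇒> e≰j))
      swap : ∀ p a k → p + (a - k) ≡ (p - k) + a
      swap = solve-∀

    peaksBounded⇒bounded : ∀ {Q} → InP a b Q → PeaksBounded Q → Bounded Q
    peaksBounded⇒bounded inP peaks P S eq with lastNorth P
    ... | allEast m         = ≤-trans (height-Eᵏ≤0 m) (+≤+ z≤n)
    ... | northThenEast X k = begin
      height (X ++ N ∷ replicate k E) ≡⟨ height-peak X k ⟩
      (height X + + a) - + (k ℕ.* b)  ≤⟨ i-j≤i (height X + + a) (+ (k ℕ.* b)) ⟩
      height X + + a                  ≤⟨ peak-bound inP peaks S X k (trans (sym (Listₚ.++-assoc X _ S)) eq) ⟩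
      + (e ℕ.* b)                     ∎
      where open ≤-Reasoning

    skeletal₀⇔InvDyck-hat : ∀ Q → InP a b Q → KStable a b 0 Q → KSkeletal a b 0 Q ⇔ IsInvDyck a b (hat e Q)
    skeletal₀⇔InvDyck-hat Q inP stable with stable⇒Eᵉ-suffix Q inP stable
    ... | B , refl = begin
      KSkeletal a b 0 Q                                                   ≈⟨ KSkeletal⇔ 0 Q ⟩
      (KStable a b 0 Q × UnstableRotations 0 Q)                           ≈⟨ mk⇔ proj₂ (stable ,_) ⟩
      UnstableRotations 0 Q                                               ≈⟨ unstable⇔peaksBounded inP ⟩
      PeaksBounded Q                                                      ≈⟨ mk⇔ (peaksBounded⇒bounded inP) bounded⇒peaksBounded ⟩
      Bounded Q                                                           ≈⟨ bounded⇔hat-nonPos B ⟩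
      NonPosPrefixes (replicate e E ++ B)                                 ≈⟨ mk⇔ (InP-++-comm B _ inP ,_) proj₂ ⟩
      (InP a b (replicate e E ++ B) × NonPosPrefixes (replicate e E ++ B)) ≈⟨ IsInvDyck⇔ _ ⟨
      IsInvDyck a b (replicate e E ++ B)                                  ≡⟨ cong (IsInvDyck a b) hat-Eᵉ ⟨
      IsInvDyck a b (hat e Q)                                             ∎
      where
      open ⇔-Reasoning
      hat-Eᵉ : hat e (B ++ replicate e E) ≡ replicate e E ++ B
      hat-Eᵉ = rotate-++ B (replicate e E) (Listₚ.length-replicate e)

    labeled-skeletal₀⇔InvDyck-lhat : ∀ Q → IsLabeledPath a b Q → KStable a b 0 (forget Q) →
                                      KSkeletal a b 0 (forget Q) ⇔ IsLabeledInvDyck a b (lhat e Q)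
    labeled-skeletal₀⇔InvDyck-lhat Q (inP , valid) stable =
      mk⇔ (λ skeletal → subst (IsInvDyck a b) (sym (forget-lhat e Q)) (Equivalence.to unlabeled skeletal) ,
                         ValidLabels-lhat e Q (proj₁ Eᵉ-suffix) (proj₂ Eᵉ-suffix) valid)
          (Equivalence.from unlabeled ∘ subst (IsInvDyck a b) (forget-lhat e Q) ∘ proj₁)
      where
      unlabeled = skeletal₀⇔InvDyck-hat (forget Q) inP stable
      Eᵉ-suffix = stable⇒Eᵉ-suffix (forget Q) inP stable

open import Data.Nat using (_≤_; _<_; _∸_)

theorem4p9 : (a b : ℕ) → Coprime a b → 1 ≤ a → 1 < b →
    -- (a)
    ((Q : List Step) → InP a b Q → KStable a b 0 Q →
       (KSkeletal a b (b ∸ 1) Q ⇔ IsDyck a b Q))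
  × -- (b)
    ((Q : List Step) → InP a b Q → KStable a b 0 Q →
       (KSkeletal a b 0 Q ⇔ IsInvDyck a b (hat (eOf a b) Q)))
  × -- (c) Q ↦ Q* = reverse Q is a bijection Dyck → inverted Dyck
    (((Q : List Step) → IsDyck a b Q → IsInvDyck a b (reverse Q))
     × ((Q Q′ : List Step) → IsDyck a b Q → IsDyck a b Q′ →
          reverse Q ≡ reverse Q′ → Q ≡ Q′)
     × ((R : List Step) → IsInvDyck a b R →
          ∃[ Q ] (IsDyck a b Q × reverse Q ≡ R)))
  × -- (d) labeled analogue of (a)
    ((Q : List LStep) → IsLabeledPath a b Q → KStable a b 0 (forget Q) →
       (KSkeletal a b (b ∸ 1) (forget Q) ⇔ IsLabeledDyck a b Q))
  × -- (d) labeled analogue of (b)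
    ((Q : List LStep) → IsLabeledPath a b Q → KStable a b 0 (forget Q) →
       (KSkeletal a b 0 (forget Q) ⇔ IsLabeledInvDyck a b (lhat (eOf a b) Q)))
  × -- (d) labeled analogue of (c)
    (((Q : List LStep) → IsLabeledDyck a b Q → IsLabeledInvDyck a b (lstar Q))
     × ((Q Q′ : List LStep) → IsLabeledDyck a b Q → IsLabeledDyck a b Q′ →
          lstar Q ≡ lstar Q′ → Q ≡ Q′)
     × ((R : List LStep) → IsLabeledInvDyck a b R →
          ∃[ Q ] (IsLabeledDyck a b Q × lstar Q ≡ R)))
theorem4p9 a b coprime _ 1<b =
  (λ Q inP _ → skeletal⇔Dyck inP) ,
  skeletal₀⇔InvDyck-hat coprime 1<b ,
  (Dyck⇒InvDyck-reverse , (λ _ _ _ _ → Listₚ.reverse-injective) ,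
   λ R inv → reverse R , InvDyck⇒Dyck-reverse R inv , Listₚ.reverse-involutive R) ,
  (λ Q labeled _ → labeled-skeletal⇔Dyck Q labeled) ,
  labeled-skeletal₀⇔InvDyck-lhat coprime 1<b ,
  (labeledDyck⇒InvDyck-lstar , lstar-injective , lstar-surjective)
  where open Paths a b
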